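{- Let $n,m$ be positive integers such that $t(n+i)=t(m+i)$ for every integer $i\ge 0$. Then $n=m$.
   Context: For each positive integer $n$, define a finite ordered (planar) rooted tree $t(n)$ recursively: $t(1)$ is the tree consisting of a single root vertex; if $n>1$ has prime factorization $n=p_1^{n_1}\cdots p_k^{n_k}$ with primes $p_1<\dots<p_k$ and exponents $n_i\ge 1$, then $t(n)$ is the ordered rooted tree whose root has exactly $k$ children, ordered from left to right, where the subtree rooted at the $i$-th child is $t(n_i)$. Trees are compared as ordered rooted trees (up to isomorphism preserving root and the left-to-right order of children). -}

module Defs where

open import Data.Nat using (ℕ; zero; suc; _+_; _<?_; _/_)
open import Data.Nat.Divisibility using (_∣?_)
open import Data.Nat.Primality using (prime?)
open import Data.List using (List; []; _∷_; map; filter; upTo)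
open import Relation.Nullary using (yes; no)

-- Finite ordered (planar) rooted trees: a node with an ordered list of subtrees.
-- Propositional equality on this type is exactly isomorphism of ordered rooted trees.
data Tree : Set where
  node : List Tree → Tree

-- multiplicity fuel q n : exponent of the prime p = 2+q in n (fuel ≥ n suffices, n ≥ 1)
multiplicity : ℕ → ℕ → ℕ → ℕ
multiplicity zero q n = 0
multiplicity (suc k) q n with (2 + q) ∣? n
... | yes _ = suc (multiplicity k q (n / (2 + q)))
... | no _ = 0

-- exponents n : the list [n_1, ..., n_k] of (positive) exponents in the prime
-- factorisation of n, ordered by increasing prime p_1 < ... < p_k.
exponents : ℕ → List ℕ
exponents n =
  filter (0 <?_) (map (λ q → multiplicity n q n) (filter (λ q → prime? (2 + q)) (upTo n)))

-- tree with fuel: tFuel k m = t(m) whenever 1 ≤ m ≤ k+1 (exponents of m are < m)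
tFuel : ℕ → ℕ → Tree
tFuel zero m = node []
tFuel (suc k) m = node (map (tFuel k) (exponents m))

t : ℕ → Tree
t n = tFuel n n

{-# OPTIONS --safe #-}

-- The root of t(K) has ω(K) children, ω(K) being the number of distinct prime divisors of K.
-- If t(n + i) = t(m + i) for all i with n < m, then t is periodic with period D = m − n from n on,
-- so t(K₀) = t(K₀ + K₀²D) for K₀ = 2ⁿ⁺¹ ≥ n. But ω(K₀) = 1, whereas K₀ + K₀²D = K₀ (1 + K₀D)
-- is even and has the odd factor 1 + K₀D > 1, so it has at least two prime divisors.
module Submission where

open import Defs
open import Data.Nat using (ℕ; _+_; _<_)
open import Relation.Binary.PropositionalEquality using (_≡_)

open import Data.Nat using (zero; suc; _*_; _^_; _∸_; _≤_; _<?_; z≤n; s≤s)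
open import Data.Nat.Properties
open import Data.Nat.Divisibility
open import Data.Nat.Primality using (Prime; prime?; prime[2]; ¬prime[1]; euclidsLemma; prime⇒irreducible)
open import Data.Nat.Primality.Factorisation using (factorise)
open import Data.Nat.ListAction using (product)
open import Data.Nat.Solver using (module +-*-Solver)
open +-*-Solver using (solve; _:+_; _:*_; _:=_; con)
open import Data.List using (List; []; _∷_; map; filter; upTo; length)
open import Data.List.Properties using (length-map)
open import Data.List.Membership.Propositional using (_∈_)
open import Data.List.Membership.Propositional.Properties using (∈-filter⁺; ∈-filter⁻; ∈-upTo⁺)
open import Data.List.Relation.Unary.Any using (here; there)
open import Data.List.Relation.Unary.All using (_∷_)
open import Data.List.Relation.Unary.AllPairs using (_∷_)
open import Data.List.Relation.Unary.Unique.Propositional using (Unique)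
import Data.List.Relation.Unary.Unique.Propositional.Properties as Unique
open import Data.Product using (∃-syntax; _×_; _,_; uncurry)
open import Data.Sum using (inj₁; inj₂)
open import Data.Bool using (true; false)
open import Function using (_∘_)
open import Relation.Nullary using (¬_; yes; no; does; contradiction)
open import Relation.Unary using (Pred; Decidable)
open import Relation.Binary.PropositionalEquality using (_≢_; refl; sym; trans; cong; subst; module ≡-Reasoning)
open import Relation.Binary.Definitions using (tri<; tri≈; tri>)

length-filter-map : ∀ {A B : Set} {ℓ} {P : Pred B ℓ} (P? : Decidable P) (h : A → B) xs →
  length (filter P? (map h xs)) ≡ length (filter (P? ∘ h) xs)
length-filter-map P? h [] = refl
length-filter-map P? h (x ∷ xs) with does (P? (h x))
... | true = cong suc (length-filter-map P? h xs)
... | false = length-filter-map P? h xs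

length≤1 : ∀ {A : Set} {a : A} {xs} → Unique xs → (∀ {y} → y ∈ xs → y ≡ a) → length xs ≤ 1
length≤1 {xs = []} _ _ = z≤n
length≤1 {xs = _ ∷ []} _ _ = s≤s z≤n
length≤1 {xs = _ ∷ _ ∷ _} ((x≢y ∷ _) ∷ _) ≡a =
  contradiction (trans (≡a (here refl)) (sym (≡a (there (here refl))))) x≢y

2≤length : ∀ {A : Set} {a b : A} {xs} → a ∈ xs → b ∈ xs → a ≢ b → 2 ≤ length xs
2≤length {xs = _ ∷ _ ∷ _} _ _ _ = s≤s (s≤s z≤n)
2≤length {xs = _ ∷ []} (here refl) (here refl) a≢b = contradiction refl a≢b
2≤length {xs = _ ∷ []} (there ()) _ _
2≤length {xs = _ ∷ []} _ (there ()) _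

multiplicity-pos : ∀ f q n → 2 + q ∣ n → 0 < multiplicity (suc f) q n
multiplicity-pos f q n d with 2 + q ∣? n
... | yes _ = s≤s z≤n
... | no ∤ = contradiction d ∤

multiplicity-pos⇒∣ : ∀ f q n → 0 < multiplicity f q n → 2 + q ∣ n
multiplicity-pos⇒∣ (suc f) q n pos with 2 + q ∣? n
... | yes d = d

-- The prime 2 + q is represented by its code q, as in multiplicity.
primeCodes : ℕ → List ℕ
primeCodes K = filter (λ q → prime? (2 + q)) (upTo K)

primeDivisorCodes : ℕ → List ℕ
primeDivisorCodes K = filter (λ q → 0 <? multiplicity K q K) (primeCodes K)

ω : ℕ → ℕ
ω K = length (primeDivisorCodes K)

∈-primeDivisorCodes⁺ : ∀ {K q} → 0 < K → Prime (2 + q) → 2 + q ∣ K → q ∈ primeDivisorCodes K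
∈-primeDivisorCodes⁺ {suc K} {q} _ p d =
  ∈-filter⁺ (λ q → 0 <? multiplicity (suc K) q (suc K))
            (∈-filter⁺ (λ q → prime? (2 + q)) (∈-upTo⁺ (≤-trans (n≤1+n (suc q)) (∣⇒≤ d))) p)
            (multiplicity-pos K q (suc K) d)

∈-primeDivisorCodes⁻ : ∀ {K q} → q ∈ primeDivisorCodes K → Prime (2 + q) × 2 + q ∣ K
∈-primeDivisorCodes⁻ {K} {q} q∈ with ∈-filter⁻ (λ q → 0 <? multiplicity K q K) {xs = primeCodes K} q∈
... | q∈primes , pos with ∈-filter⁻ (λ q → prime? (2 + q)) {xs = upTo K} q∈primes
... | _ , p = p , multiplicity-pos⇒∣ K q K pos

ω≤1 : ∀ {K c} → (∀ {q} → Prime (2 + q) → 2 + q ∣ K → q ≡ c) → ω K ≤ 1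
ω≤1 {K} unique-prime =
  length≤1 (Unique.filter⁺ (λ q → 0 <? multiplicity K q K)
             (Unique.filter⁺ (λ q → prime? (2 + q)) (Unique.upTo⁺ K)))
           (uncurry unique-prime ∘ ∈-primeDivisorCodes⁻)

2≤ω : ∀ {K p q} → 0 < K → Prime (2 + p) → Prime (2 + q) → p ≢ q → 2 + p ∣ K → 2 + q ∣ K → 2 ≤ ω K
2≤ω K>0 pp pq p≢q p∣K q∣K =
  2≤length (∈-primeDivisorCodes⁺ K>0 pp p∣K) (∈-primeDivisorCodes⁺ K>0 pq q∣K) p≢q

rootDegree : Tree → ℕ
rootDegree (node ts) = length ts

rootDegree-t : ∀ K → 0 < K → rootDegree (t K) ≡ ω K
rootDegree-t (suc K) _ =
  trans (length-map (tFuel K) (exponents (suc K)))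
        (length-filter-map (0 <?_) (λ q → multiplicity (suc K) q (suc K)) (primeCodes (suc K)))

t≡⇒ω≡ : ∀ {a b} → 0 < a → 0 < b → t a ≡ t b → ω a ≡ ω b
t≡⇒ω≡ {a} {b} a>0 b>0 e =
  trans (sym (rootDegree-t a a>0)) (trans (cong rootDegree e) (rootDegree-t b b>0))

prime∣prime^⇒≡ : ∀ {p r} a → Prime p → Prime r → p ∣ r ^ a → p ≡ r
prime∣prime^⇒≡ zero pp _ p∣1 = contradiction (subst Prime (∣1⇒≡1 p∣1) pp) ¬prime[1]
prime∣prime^⇒≡ {r = r} (suc a) pp pr p∣r^1+a with euclidsLemma r (r ^ a) pp p∣r^1+a
... | inj₂ p∣r^a = prime∣prime^⇒≡ a pp pr p∣r^a
... | inj₁ p∣r with prime⇒irreducible pr p∣r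
...   | inj₁ p≡1 = contradiction (subst Prime p≡1 pp) ¬prime[1]
...   | inj₂ p≡r = p≡r

ω[p^a]≤1 : ∀ {c} → Prime (2 + c) → ∀ a → ω ((2 + c) ^ a) ≤ 1
ω[p^a]≤1 pc a = ω≤1 (λ pq q∣ → cong (_∸ 2) (prime∣prime^⇒≡ a pq pc q∣))

primeFactor : ∀ M → 2 ≤ M → ∃[ q ] Prime (2 + q) × 2 + q ∣ M
primeFactor 0 ()
primeFactor 1 (s≤s ())
primeFactor M@(suc (suc _)) _ with factorise M
... | record { factors = [] ; isFactorisation = () }
... | record { factors = 0 ∷ _ ; factorsPrime = p0 ∷ _ } = contradiction p0 λ ()
... | record { factors = 1 ∷ _ ; factorsPrime = p1 ∷ _ } = contradiction p1 ¬prime[1]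
... | record { factors = suc (suc q) ∷ ps ; isFactorisation = e ; factorsPrime = pq ∷ _ } =
  q , pq , subst (2 + q ∣_) (sym e) (m∣m*n (product ps))

2≤ω[even*odd] : ∀ {a b} → 0 < a → 2 ∣ a → 2 ≤ b → ¬ 2 ∣ b → 2 ≤ ω (a * b)
2≤ω[even*odd] {a} {b} a>0 2∣a b≥2 2∤b with primeFactor b b≥2
... | q , pq , q∣b =
  2≤ω (*-mono-≤ a>0 (≤-trans (s≤s z≤n) b≥2)) prime[2] pq 0≢q (∣m⇒∣m*n b 2∣a) (∣n⇒∣m*n a q∣b)
  where
  0≢q : 0 ≢ q
  0≢q refl = 2∤b q∣b

¬2∣1+even : ∀ {m} → 2 ∣ m → ¬ 2 ∣ 1 + m
¬2∣1+even {m} 2∣m 2∣1+m with ∣1⇒≡1 (∣m+n∣m⇒∣n (subst (2 ∣_) (+-comm 1 m) 2∣1+m) 2∣m)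
... | ()

n<2^n : ∀ n → n < 2 ^ n
n<2^n zero = s≤s z≤n
n<2^n (suc n) = ≤-trans (s≤s (n<2^n n)) (+-mono-≤ (m^n>0 2 n) (m≤m+n (2 ^ n) 0))

module _ {A : Set} (f : ℕ → A) {n D : ℕ} (shift : ∀ i → f (n + i) ≡ f (n + D + i)) where
  open ≡-Reasoning

  periodic-step : ∀ {x} → n ≤ x → f x ≡ f (x + D)
  periodic-step {x} n≤x = begin
    f x                  ≡⟨ cong f (sym (m+[n∸m]≡n n≤x)) ⟩
    f (n + (x ∸ n))      ≡⟨ shift (x ∸ n) ⟩
    f (n + D + (x ∸ n))  ≡⟨ cong f (solve 3 (λ n D k → n :+ D :+ k := n :+ k :+ D) refl n D (x ∸ n)) ⟩
    f (n + (x ∸ n) + D)  ≡⟨ cong (λ y → f (y + D)) (m+[n∸m]≡n n≤x) ⟩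
    f (x + D)            ∎

  periodic : ∀ {x} → n ≤ x → ∀ j → f x ≡ f (x + j * D)
  periodic {x} _ zero = cong f (sym (+-identityʳ x))
  periodic {x} n≤x (suc j) = begin
    f x                ≡⟨ periodic-step n≤x ⟩
    f (x + D)          ≡⟨ periodic (≤-trans n≤x (m≤m+n x D)) j ⟩
    f (x + D + j * D)  ≡⟨ cong f (+-assoc x D (j * D)) ⟩
    f (x + suc j * D)  ∎

t-not-eventually-periodic : ∀ n D → 0 < D → ¬ (∀ i → t (n + i) ≡ t (n + D + i))
t-not-eventually-periodic n D D>0 shift =
  <⇒≱ (subst (2 ≤_) (sym ω[K₀]≡ω[K₁]) 2≤ω[K₁]) (ω[p^a]≤1 prime[2] (suc n))
  where
  K₀ = 2 ^ suc n
  K₁ = K₀ * (1 + K₀ * D)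
  K₀>0 : 0 < K₀
  K₀>0 = m^n>0 2 (suc n)
  2∣K₀ : 2 ∣ K₀
  2∣K₀ = m∣m*n (2 ^ n)
  K₀+K₀K₀D≡K₁ : K₀ + K₀ * K₀ * D ≡ K₁
  K₀+K₀K₀D≡K₁ = solve 2 (λ k d → k :+ k :* k :* d := k :* (con 1 :+ k :* d)) refl K₀ D
  n≤K₀ : n ≤ K₀
  n≤K₀ = ≤-trans (n≤1+n n) (<⇒≤ (n<2^n (suc n)))
  t[K₀]≡t[K₁] : t K₀ ≡ t K₁
  t[K₀]≡t[K₁] = trans (periodic t shift n≤K₀ (K₀ * K₀)) (cong t K₀+K₀K₀D≡K₁)
  2≤ω[K₁] : 2 ≤ ω K₁
  2≤ω[K₁] = 2≤ω[even*odd] K₀>0 2∣K₀ (s≤s (*-mono-≤ K₀>0 D>0)) (¬2∣1+even (∣m⇒∣m*n D 2∣K₀))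
  ω[K₀]≡ω[K₁] : ω K₀ ≡ ω K₁
  ω[K₀]≡ω[K₁] = t≡⇒ω≡ K₀>0 (*-mono-≤ K₀>0 (s≤s z≤n)) t[K₀]≡t[K₁]

t-shifts-differ : ∀ {n m} → n < m → ¬ (∀ i → t (n + i) ≡ t (m + i))
t-shifts-differ {n} {m} n<m agree = t-not-eventually-periodic n (m ∸ n) (m<n⇒0<n∸m n<m) shift
  where
  shift : ∀ i → t (n + i) ≡ t (n + (m ∸ n) + i)
  shift i = subst (λ k → t (n + i) ≡ t (k + i)) (sym (m+[n∸m]≡n (<⇒≤ n<m))) (agree i)

mainTheorem4 : (n m : ℕ) → 0 < n → 0 < m →
    ((i : ℕ) → t (n + i) ≡ t (m + i)) → n ≡ m
mainTheorem4 n m _ _ agree with <-cmp n m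
... | tri< n<m _ _ = contradiction agree (t-shifts-differ n<m)
... | tri≈ _ n≡m _ = n≡m
... | tri> _ _ m<n = contradiction (sym ∘ agree) (t-shifts-differ m<n)
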